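{- Let $(C,\sqsubseteq)$ be a complete lattice, $b^*,b_*\colon C\to C$ monotone maps with $b^*$ left adjoint to $b_*$, $a\colon C\to C$ an up-closure operator and $i,f\in C$. If $a$ is $(b_*,f)$-compatible, then $a$ is $(i\sqcup b^*)$-complete, and hence also $(i\sqcup b^*,f)$-complete.
   Context: $b^*$ left adjoint to $b_*$: $b^*(x)\sqsubseteq y$ iff $x\sqsubseteq b_*(y)$. An up-closure operator is a monotone $a$ with $x\sqsubseteq a(x)$, $a(a(x))\sqsubseteq a(x)$. $a$ is $(b_*,f)$-compatible iff $a(f)\sqsubseteq f$ and $a\circ b_*\sqsubseteq b_*\circ a$. $i\sqcup b^*$ is the map $x\mapsto i\sqcup b^*(x)$. For a monotone $g$: $Pre(a)=\{x\mid a(x)\sqsubseteq x\}$, $\alpha\colon C\to Pre(a)$, $\alpha(x)=a(x)$, $\gamma$ the inclusion; $a$ is $g$-complete iff $\alpha(\mu g)=\mu(\alpha\circ g\circ\gamma)$ (least fixed point in $Pre(a)$); $a$ is $(g,f)$-complete iff $a(f)\sqsubseteq f$ and ($\mu(a\circ g)\sqsubseteq f$ iff $\mu g\sqsubseteq f$). -}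

module Defs where

open import Level using (Level; _⊔_; suc; Lift)
open import Data.Product using (_×_; Σ)
open import Data.Sum using (_⊎_)
open import Relation.Unary using (Pred)
open import Relation.Binary.Bundles using (Poset)
open import Function.Bundles using (_⇔_)

record CompleteLattice (c ℓ₁ ℓ₂ : Level) : Set (suc (c ⊔ ℓ₁ ⊔ ℓ₂)) where
  field
    poset : Poset c ℓ₁ ℓ₂
  open Poset poset public
  field
    ⋁ : Pred Carrier (ℓ₁ ⊔ ℓ₂) → Carrier
    ⋁-upper : ∀ S x → S x → x ≤ ⋁ S
    ⋁-least : ∀ S y → (∀ x → S x → x ≤ y) → ⋁ S ≤ y
    ⋀ : Pred Carrier (ℓ₁ ⊔ ℓ₂) → Carrier
    ⋀-lower : ∀ S x → S x → ⋀ S ≤ x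
    ⋀-greatest : ∀ S y → (∀ x → S x → y ≤ x) → y ≤ ⋀ S

module CL {c ℓ₁ ℓ₂ : Level} (L : CompleteLattice c ℓ₁ ℓ₂) where
  open CompleteLattice L

  _⊔ᴸ_ : Carrier → Carrier → Carrier
  x ⊔ᴸ y = ⋁ (λ z → Lift ℓ₂ ((z ≈ x) ⊎ (z ≈ y)))

  Monotone : (Carrier → Carrier) → Set (c ⊔ ℓ₂)
  Monotone g = ∀ {x y} → x ≤ y → g x ≤ g y

  LeftAdjoint : (Carrier → Carrier) → (Carrier → Carrier) → Set (c ⊔ ℓ₂)
  LeftAdjoint l r = ∀ x y → (l x ≤ y) ⇔ (x ≤ r y)

  UpClosure : (Carrier → Carrier) → Set (c ⊔ ℓ₂)
  UpClosure a = Monotone a × (∀ x → x ≤ a x) × (∀ x → a (a x) ≤ a x)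

  Compatible : (Carrier → Carrier) → (Carrier → Carrier) → Carrier → Set (c ⊔ ℓ₂)
  Compatible a r f = (a f ≤ f) × (∀ x → a (r x) ≤ r (a x))

  join-const : Carrier → (Carrier → Carrier) → Carrier → Carrier
  join-const i h x = i ⊔ᴸ h x

  -- least fixed point (Knaster–Tarski): meet of all pre-fixed points
  μ : (Carrier → Carrier) → Carrier
  μ g = ⋀ (λ x → Lift ℓ₁ (g x ≤ x))

  Pre : (Carrier → Carrier) → Pred Carrier ℓ₂
  Pre a x = a x ≤ x

  IsLeastFixedPointIn : ∀ {p} → Pred Carrier p → (Carrier → Carrier) → Carrier → Set (c ⊔ ℓ₁ ⊔ ℓ₂ ⊔ p)
  IsLeastFixedPointIn P h x = P x × (h x ≈ x) × (∀ y → P y → h y ≈ y → x ≤ y)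

  -- a is g-complete:  α(μ g) = μ(α ∘ g ∘ γ)  (least fixed point taken in Pre(a))
  IsComplete : (Carrier → Carrier) → (Carrier → Carrier) → Set (c ⊔ ℓ₁ ⊔ ℓ₂)
  IsComplete a g = IsLeastFixedPointIn (Pre a) (λ x → a (g x)) (a (μ g))

  IsCompleteFor : (Carrier → Carrier) → (Carrier → Carrier) → Carrier → Set ℓ₂
  IsCompleteFor a g f = (a f ≤ f) × ((μ (λ x → a (g x)) ≤ f) ⇔ (μ g ≤ f))

module Submission where

-- The theorem is an instance of a general principle: if an
-- up-closure operator a laxly commutes with a monotone map g, in the sense
-- g ∘ a ⊑ a ∘ g, then a(μ g) is the least fixed point of a ∘ g inside
-- Pre(a), i.e. a is g-complete; and whenever a f ⊑ f this yields
-- (g , f)-completeness, since μ g ⊑ μ(a ∘ g) ⊑ a(μ g).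

open import Defs
open import Data.Product using (_×_; _,_; proj₁; proj₂)
open import Data.Sum using (inj₁; inj₂)
open import Level using (_⊔_; lift; lower)
open import Function.Bundles using (mk⇔; Equivalence)

module LatticeFacts {c ℓ₁ ℓ₂} (L : CompleteLattice c ℓ₁ ℓ₂) where
  open CompleteLattice L
  open CL L

  LaxCommute : (Carrier → Carrier) → (Carrier → Carrier) → Set (c ⊔ ℓ₂)
  LaxCommute h k = ∀ x → h (k x) ≤ k (h x)

  ⊔-upperˡ : ∀ x y → x ≤ x ⊔ᴸ y
  ⊔-upperˡ x y = ⋁-upper _ x (lift (inj₁ Eq.refl))

  ⊔-upperʳ : ∀ x y → y ≤ x ⊔ᴸ y
  ⊔-upperʳ x y = ⋁-upper _ y (lift (inj₂ Eq.refl))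

  ⊔-least : ∀ {x y z} → x ≤ z → y ≤ z → x ⊔ᴸ y ≤ z
  ⊔-least {z = z} x≤z y≤z = ⋁-least _ z λ where
    _ (lift (inj₁ w≈x)) → trans (reflexive w≈x) x≤z
    _ (lift (inj₂ w≈y)) → trans (reflexive w≈y) y≤z

  μ-least : ∀ g y → g y ≤ y → μ g ≤ y
  μ-least g y gy≤y = ⋀-lower _ y (lift gy≤y)

  μ-mono : ∀ {g h} → (∀ x → g x ≤ h x) → μ g ≤ μ h
  μ-mono {g} g≤h = ⋀-greatest _ _ λ x hx≤x →
    μ-least g x (trans (g≤h x) (lower hx≤x))

  μ-prefixed : ∀ {g} → Monotone g → g (μ g) ≤ μ g
  μ-prefixed {g} mono-g = ⋀-greatest _ _ λ x gx≤x →
    trans (mono-g (μ-least g x (lower gx≤x))) (lower gx≤x)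

  μ-postfixed : ∀ {g} → Monotone g → μ g ≤ g (μ g)
  μ-postfixed {g} mono-g = μ-least g (g (μ g)) (mono-g (μ-prefixed mono-g))

  adjoint-unit : ∀ {l r} → LeftAdjoint l r → ∀ x → x ≤ r (l x)
  adjoint-unit {l} adj x = Equivalence.to (adj x (l x)) refl

  adjoint-transfer : ∀ {l r a} → LeftAdjoint l r → Monotone a →
                     LaxCommute a r → LaxCommute l a
  adjoint-transfer {l} {a = a} adj mono-a ar⊑ra x =
    Equivalence.from (adj (a x) (a (l x)))
      (trans (mono-a (adjoint-unit adj x)) (ar⊑ra (l x)))

  join-const-mono : ∀ {h} i → Monotone h → Monotone (join-const i h)
  join-const-mono {h} i mono-h {x} {y} x≤y =
    ⊔-least (⊔-upperˡ i (h y)) (trans (mono-h x≤y) (⊔-upperʳ i (h y)))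

  -- For an extensive monotone a, joining with a constant preserves
  -- h ∘ a ⊑ a ∘ h (the constant part is absorbed by extensivity).
  join-const-laxCommute : ∀ {h a} i → Monotone a → (∀ x → x ≤ a x) →
                          LaxCommute h a → LaxCommute (join-const i h) a
  join-const-laxCommute {h} {a} i mono-a extensive ha⊑ah x =
    ⊔-least (trans (extensive i) (mono-a (⊔-upperˡ i (h x))))
            (trans (ha⊑ah x) (mono-a (⊔-upperʳ i (h x))))

module Completeness {c ℓ₁ ℓ₂} (L : CompleteLattice c ℓ₁ ℓ₂)
    {a g : CompleteLattice.Carrier L → CompleteLattice.Carrier L}
    (up : CL.UpClosure L a) (mono-g : CL.Monotone L g)
    (ga⊑ag : LatticeFacts.LaxCommute L g a) where
  open CompleteLattice L
  open CL L
  open LatticeFacts L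

  private
    mono-a : Monotone a
    mono-a = proj₁ up
    extensive : ∀ x → x ≤ a x
    extensive = proj₁ (proj₂ up)
    idempotent : ∀ x → a (a x) ≤ a x
    idempotent = proj₂ (proj₂ up)

  -- a (μ g) is a pre-fixed point of a ∘ g:
  -- a g a (μ g) ⊑ a a g (μ g) ⊑ a g (μ g) ⊑ a (μ g).
  closure-prefixed : a (g (a (μ g))) ≤ a (μ g)
  closure-prefixed =
    trans (mono-a (ga⊑ag (μ g)))
          (trans (idempotent (g (μ g))) (mono-a (μ-prefixed mono-g)))

  -- ... and a post-fixed point: a (μ g) ⊑ a g (μ g) ⊑ a g a (μ g).
  closure-postfixed : a (μ g) ≤ a (g (a (μ g)))
  closure-postfixed =
    trans (mono-a (μ-postfixed mono-g)) (mono-a (mono-g (extensive (μ g))))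

  -- Every fixed point y of a ∘ g in Pre(a) is a pre-fixed point of g,
  -- hence lies above μ g and, being closed, above a (μ g).
  closure-least : ∀ y → Pre a y → a (g y) ≈ y → a (μ g) ≤ y
  closure-least y ay≤y agy≈y =
    trans (mono-a (μ-least g y (trans (extensive (g y)) (reflexive agy≈y))))
          ay≤y

  complete : IsComplete a g
  complete = idempotent (μ g)
           , antisym closure-prefixed closure-postfixed
           , closure-least

  -- μ g ⊑ μ (a ∘ g) ⊑ a (μ g), so both least fixed points lie below f
  -- together as soon as f is closed.
  completeFor : ∀ {f} → a f ≤ f → IsCompleteFor a g f
  completeFor {f} af≤f = af≤f , mk⇔
    (trans (μ-mono λ x → extensive (g x)))
    (λ μg≤f → trans (μ-least (λ x → a (g x)) (a (μ g)) closure-prefixed)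
                    (trans (mono-a μg≤f) af≤f))

corollary9p9 : ∀ {c ℓ₁ ℓ₂} (L : CompleteLattice c ℓ₁ ℓ₂)
    (b^* b_* a : CompleteLattice.Carrier L → CompleteLattice.Carrier L)
    (i f : CompleteLattice.Carrier L) →
    CL.Monotone L b^* → CL.Monotone L b_* → CL.LeftAdjoint L b^* b_* →
    CL.UpClosure L a → CL.Compatible L a b_* f →
    CL.IsComplete L a (CL.join-const L i b^*) × CL.IsCompleteFor L a (CL.join-const L i b^*) f
corollary9p9 L b^* b_* a i f mono-b^* _ adj up@(mono-a , extensive , _) (af≤f , ab_*⊑b_*a) =
  complete , completeFor af≤f
  where
    open LatticeFacts L

    -- Compatibility with b_* gives b^* ∘ a ⊑ a ∘ b^* by adjunction,
    -- and hence (i ⊔ b^*) ∘ a ⊑ a ∘ (i ⊔ b^*).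
    b^*a⊑ab^* : LaxCommute b^* a
    b^*a⊑ab^* = adjoint-transfer adj mono-a ab_*⊑b_*a

    open Completeness L up (join-const-mono i mono-b^*)
                         (join-const-laxCommute i mono-a extensive b^*a⊑ab^*)
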